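{- Let $m$ be real and let $\alpha_0,\alpha_1,\ldots$ be real numbers such that the numbers $\alpha_i+im$, $i\ge0$, are pairwise distinct. Then for all integers $n,k\ge0$, \[ L_{m,\bar{\alpha}}(n,k)=\sum_{j=0}^k\frac{\prod_{i=0}^{n-1}(\alpha_j+jm+\alpha_i+im)}{\prod_{i=0,i\neq j}^k(\alpha_j+jm-\alpha_i-im)}, \] and for all integers $n\ge k\ge1$, \[ L_{m,\bar{\alpha}}(n,k)=\sum_{j=k}^n L_{m,\bar{\alpha}}(j-1,k-1)\prod_{i=j}^{n-1}(\alpha_i+im+\alpha_k+km). \]
   Context: For real $m$ and reals $\bar{\alpha}=(\alpha_0,\alpha_1,\ldots)$ let $(x;\bar{\alpha}|m)_n=\prod_{j=0}^{n-1}(x-\alpha_j-jm)$ with $(x;\bar{\alpha}|m)_0=1$. The $\bar{\alpha}$-Whitney numbers of the first kind $w_{m,\bar{\alpha}}(n,k)$ and second kind $W_{m,\bar{\alpha}}(n,k)$ are defined by $(x;\bar{\alpha}|m)_n=\sum_{k=0}^n w_{m,\bar{\alpha}}(n,k)x^k$ and $x^n=\sum_{k=0}^n W_{m,\bar{\alpha}}(n,k)(x;\bar{\alpha}|m)_k$ (both zero for $k>n$ or $k<0$). The $\bar{\alpha}$-Whitney-Lah numbers are $L_{m,\bar{\alpha}}(n,k)=\sum_{j=k}^n(-1)^{n-j}w_{m,\bar{\alpha}}(n,j)W_{m,\bar{\alpha}}(j,k)$, with $L_{m,\bar{\alpha}}(0,0)=1$ and $L_{m,\bar{\alpha}}(n,k)=0$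 for $n<k$ or $k<0$. -}

module Defs where

open import Level using (Level; _⊔_) renaming (suc to lsuc)
open import Data.Nat using (ℕ; zero; suc; _≡ᵇ_) renaming (_+_ to _+ℕ_; _∸_ to _∸ℕ_)
open import Data.Bool using (if_then_else_)
open import Relation.Nullary using (¬_)
open import Algebra.Bundles using (CommutativeRing)

record Field (c ℓ : Level) : Set (lsuc (c ⊔ ℓ)) where
  field
    commutativeRing : CommutativeRing c ℓ
  open CommutativeRing commutativeRing public
  field
    _⁻¹       : Carrier → Carrier
    0≉1       : ¬ (0# ≈ 1#)
    inverseʳ  : ∀ x → ¬ (x ≈ 0#) → (x * (x ⁻¹)) ≈ 1#

module Whitney {c ℓ : Level} (F : Field c ℓ) (m : Field.Carrier F) (α : ℕ → Field.Carrier F) where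
  open Field F hiding (zero)

  ι : ℕ → Carrier
  ι zero    = 0#
  ι (suc n) = 1# + ι n

  β : ℕ → Carrier
  β i = α i + (ι i * m)

  ∑ : ℕ → (ℕ → Carrier) → Carrier
  ∑ zero    f = 0#
  ∑ (suc n) f = ∑ n f + f n

  ∏ : ℕ → (ℕ → Carrier) → Carrier
  ∏ zero    f = 1#
  ∏ (suc n) f = ∏ n f * f n

  negOnePow : ℕ → Carrier
  negOnePow zero    = 1#
  negOnePow (suc e) = - negOnePow e

  -- First kind: coefficients of (x;α|m)_n = ∏_{j<n} (x - β j),
  -- via (x;α|m)_{n+1} = (x;α|m)_n · (x - β n).
  w : ℕ → ℕ → Carrier
  w zero    zero    = 1#
  w zero    (suc k) = 0#
  w (suc n) zero    = - (β n * w n zero)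
  w (suc n) (suc k) = w n k - (β n * w n (suc k))

  -- Second kind: x^n = ∑_k W(n,k) (x;α|m)_k, via x·(x;α|m)_k = (x;α|m)_{k+1} + β k·(x;α|m)_k.
  W : ℕ → ℕ → Carrier
  W zero    zero    = 1#
  W zero    (suc k) = 0#
  W (suc n) zero    = β zero * W n zero
  W (suc n) (suc k) = W n k + (β (suc k) * W n (suc k))

  -- L(n,k) = ∑_{j=k}^{n} (-1)^{n-j} w(n,j) W(j,k)   (empty sum = 0 when n < k)
  L : ℕ → ℕ → Carrier
  L n k = ∑ (suc n ∸ℕ k) (λ t → negOnePow (n ∸ℕ (k +ℕ t)) * (w n (k +ℕ t) * W (k +ℕ t) k))

  denom : ℕ → ℕ → Carrier
  denom j k = ∏ (suc k) (λ i → if i ≡ᵇ j then 1# else (β j - β i))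

-- With w⁺(n,j) = (−1)^(n−j) w(n,j), the coefficients of ∏_{i<n} (x + β i), both w⁺ and W obey
-- Pascal-type recurrences; inserting them into L(n,k) = ∑_j w⁺(n,j) W(j,k) gives
--   L(n+1,0) = (β 0 + β n) L(n,0),   L(n+1,k+1) = L(n,k) + (β (k+1) + β n) L(n,k+1),
-- and L(n,k) = 0 for n < k. Unrolling this first-order recurrence in n gives the second formula.
-- The closed form satisfies the same recurrence, since β j + β n = (β j − β k) + (β k + β n) and
-- the factor β j − β k cancels against denom j k; its row n = 0 is 1, 0, 0, …, the zeros being the
-- partial-fraction identity ∑_x 1 / ∏_{y ≠ x} (x − y) = 0 over at least two distinct points.

module Submission where

open import Defs
open import Level using (Level)
open import Data.Nat using (ℕ; zero; suc; _∸_; _≤_; _<_; s≤s; z≤n; _≡ᵇ_; _<?_; _≤?_)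
import Data.Nat as ℕ
import Data.Nat.Properties as ℕ
open import Data.Bool using (if_then_else_)
open import Data.Product using (_×_; _,_)
open import Data.Maybe using (Maybe; just; nothing)
open import Relation.Nullary using (¬_; yes; no; contradiction)
open import Relation.Binary.PropositionalEquality as ≡ using (_≡_; _≢_; ≢-sym)
open import Algebra.Bundles using (CommutativeRing; RawRing)
open import Algebra.Solver.Ring.AlmostCommutativeRing using (_-Raw-AlmostCommutative⟶_; fromCommutativeRing)

if-≡ᵇ-refl : ∀ {a} {A : Set a} n {x y : A} → (if n ≡ᵇ n then x else y) ≡ x
if-≡ᵇ-refl zero    = ≡.refl
if-≡ᵇ-refl (suc n) = if-≡ᵇ-refl n

if-≡ᵇ-≢ : ∀ {a} {A : Set a} {i j} {x y : A} → i ≢ j → (if i ≡ᵇ j then x else y) ≡ y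
if-≡ᵇ-≢ {i = zero}  {zero}  i≢j = contradiction ≡.refl i≢j
if-≡ᵇ-≢ {i = zero}  {suc j} _   = ≡.refl
if-≡ᵇ-≢ {i = suc i} {zero}  _   = ≡.refl
if-≡ᵇ-≢ {i = suc i} {suc j} i≢j = if-≡ᵇ-≢ (λ i≡j → i≢j (≡.cong suc i≡j))

1+[i+t+[e∸[1+t]]]≡i+e : ∀ i {t e} → t < e → suc (i ℕ.+ t ℕ.+ (e ∸ suc t)) ≡ i ℕ.+ e
1+[i+t+[e∸[1+t]]]≡i+e i {t} {e} t<e = begin
  suc (i ℕ.+ t ℕ.+ (e ∸ suc t))  ≡⟨ ≡.sym (ℕ.+-suc (i ℕ.+ t) (e ∸ suc t)) ⟩
  i ℕ.+ t ℕ.+ suc (e ∸ suc t)    ≡⟨ ≡.cong (i ℕ.+ t ℕ.+_) (≡.sym (ℕ.+-∸-assoc 1 t<e)) ⟩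
  i ℕ.+ t ℕ.+ (e ∸ t)            ≡⟨ ℕ.+-assoc i t (e ∸ t) ⟩
  i ℕ.+ (t ℕ.+ (e ∸ t))          ≡⟨ ≡.cong (i ℕ.+_) (ℕ.m+[n∸m]≡n (ℕ.<⇒≤ t<e)) ⟩
  i ℕ.+ e                        ∎
  where open ≡.≡-Reasoning

-- Integers as pairs (a , b) standing for a − b, normalised so that one side is 0: then ≡ is
-- equality of integers, which gives the ring solver decidable integer coefficients in any
-- commutative ring (with the ring's own elements as coefficients, 1# + - 1# would not reduce to 0#).
ℤ₂ : Set
ℤ₂ = ℕ × ℕ

normalise : ℕ → ℕ → ℤ₂
normalise a b = (a ∸ b , b ∸ a)

ℤ₂-rawRing : RawRing _ _
ℤ₂-rawRing = record
  { Carrier = ℤ₂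
  ; _≈_     = _≡_
  ; _+_     = λ { (a , b) (c , d) → normalise (a ℕ.+ c) (b ℕ.+ d) }
  ; _*_     = λ { (a , b) (c , d) → normalise (a ℕ.* c ℕ.+ b ℕ.* d) (a ℕ.* d ℕ.+ b ℕ.* c) }
  ; -_      = λ { (a , b) → (b , a) }
  ; 0#      = (0 , 0)
  ; 1#      = (1 , 0)
  }

module IntegerRingSolver {c ℓ} (R : CommutativeRing c ℓ) where
  open CommutativeRing R
  open import Algebra.Properties.Ring ring using (-‿distribˡ-*; -‿distribʳ-*; -‿involutive)
  open import Algebra.Properties.AbelianGroup +-abelianGroup using (⁻¹-∙-comm; ⁻¹-anti-homo‿-)
  open import Algebra.Properties.CommutativeSemigroup +-commutativeSemigroup using (interchange)
  open import Algebra.Properties.Semiring.Mult semiring using (×-homo-+; ×1-homo-*) renaming (_×_ to _·_)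
  import Algebra.Solver.Ring.NaturalCoefficients.Default commutativeSemiring as ℕ-Solver
  open import Relation.Binary.Reasoning.Setoid setoid

  private
    ⟦_⟧ℤ : ℤ₂ → Carrier
    ⟦ a , b ⟧ℤ = a · 1# - b · 1#

    -‿distrib-+ : ∀ x y → - (x + y) ≈ - x + - y
    -‿distrib-+ x y = sym (⁻¹-∙-comm x y)

    *-expand : ∀ a b c d → (a * c + b * d) + (a * d + b * c) ≈ (a + b) * (c + d)
    *-expand = solve 4 (λ a b c d → (a :* c :+ b :* d) :+ (a :* d :+ b :* c) := (a :+ b) :* (c :+ d)) refl
      where open ℕ-Solver using (solve; _:+_; _:*_; _:=_)

    −-cancel-suc : ∀ x y → (1# + x) - (1# + y) ≈ x - y
    −-cancel-suc x y = begin
      (1# + x) + - (1# + y)   ≈⟨ +-congˡ (-‿distrib-+ 1# y) ⟩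
      (1# + x) + (- 1# + - y) ≈⟨ interchange 1# x (- 1#) (- y) ⟩
      (1# + - 1#) + (x + - y) ≈⟨ +-congʳ (-‿inverseʳ 1#) ⟩
      0# + (x - y)            ≈⟨ +-identityˡ _ ⟩
      x - y                   ∎

    ⟦normalise⟧ : ∀ a b → ⟦ normalise a b ⟧ℤ ≈ a · 1# - b · 1#
    ⟦normalise⟧ zero    zero    = refl
    ⟦normalise⟧ zero    (suc b) = refl
    ⟦normalise⟧ (suc a) zero    = refl
    ⟦normalise⟧ (suc a) (suc b) = trans (⟦normalise⟧ a b) (sym (−-cancel-suc (a · 1#) (b · 1#)))

    ⟦⟧-homo-+ : ∀ a b c d → ⟦ normalise (a ℕ.+ c) (b ℕ.+ d) ⟧ℤ ≈ ⟦ a , b ⟧ℤ + ⟦ c , d ⟧ℤ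
    ⟦⟧-homo-+ a b c d = begin
      ⟦ normalise (a ℕ.+ c) (b ℕ.+ d) ⟧ℤ ≈⟨ ⟦normalise⟧ (a ℕ.+ c) (b ℕ.+ d) ⟩
      (a ℕ.+ c) · 1# - (b ℕ.+ d) · 1#    ≈⟨ +-cong (×-homo-+ 1# a c) (-‿cong (×-homo-+ 1# b d)) ⟩
      (A + C) + - (B + D)                 ≈⟨ +-congˡ (-‿distrib-+ B D) ⟩
      (A + C) + (- B + - D)               ≈⟨ interchange A C (- B) (- D) ⟩
      (A - B) + (C - D)                   ∎
      where A = a · 1#; B = b · 1#; C = c · 1#; D = d · 1#

    ⟦⟧-homo-* : ∀ a b c d →
      ⟦ normalise (a ℕ.* c ℕ.+ b ℕ.* d) (a ℕ.* d ℕ.+ b ℕ.* c) ⟧ℤ ≈ ⟦ a , b ⟧ℤ * ⟦ c , d ⟧ℤ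
    ⟦⟧-homo-* a b c d = begin
      ⟦ normalise (a ℕ.* c ℕ.+ b ℕ.* d) (a ℕ.* d ℕ.+ b ℕ.* c) ⟧ℤ
        ≈⟨ ⟦normalise⟧ (a ℕ.* c ℕ.+ b ℕ.* d) (a ℕ.* d ℕ.+ b ℕ.* c) ⟩
      (a ℕ.* c ℕ.+ b ℕ.* d) · 1# - (a ℕ.* d ℕ.+ b ℕ.* c) · 1#
        ≈⟨ +-cong (trans (ℕ-homo (a ℕ.* c) (b ℕ.* d)) (+-cong (×1-homo-* a c) (×1-homo-* b d)))
                  (-‿cong (trans (ℕ-homo (a ℕ.* d) (b ℕ.* c)) (+-cong (×1-homo-* a d) (×1-homo-* b c)))) ⟩
      (A * C + B * D) + - (A * D + B * C)
        ≈⟨ +-congˡ (-‿distrib-+ (A * D) (B * C)) ⟩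
      (A * C + B * D) + (- (A * D) + - (B * C))
        ≈⟨ +-cong (+-congˡ (sym negneg)) (+-cong (-‿distribʳ-* A D) (-‿distribˡ-* B C)) ⟩
      (A * C + (- B) * (- D)) + (A * (- D) + (- B) * C)
        ≈⟨ *-expand A (- B) C (- D) ⟩
      (A - B) * (C - D) ∎
      where
      A = a · 1#; B = b · 1#; C = c · 1#; D = d · 1#
      ℕ-homo = ×-homo-+ 1#
      negneg : (- B) * (- D) ≈ B * D
      negneg = trans (sym (-‿distribˡ-* B (- D)))
                     (trans (-‿cong (sym (-‿distribʳ-* B D))) (-‿involutive (B * D)))

    ⟦⟧-homo : ℤ₂-rawRing -Raw-AlmostCommutative⟶ fromCommutativeRing R
    ⟦⟧-homo = record
      { ⟦_⟧    = ⟦_⟧ℤ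
      ; +-homo = λ { (a , b) (c , d) → ⟦⟧-homo-+ a b c d }
      ; *-homo = λ { (a , b) (c , d) → ⟦⟧-homo-* a b c d }
      ; -‿homo = λ { (a , b) → sym (⁻¹-anti-homo‿- (a · 1#) (b · 1#)) }
      ; 0-homo = -‿inverseʳ 0#
      ; 1-homo = trans (+-assoc 1# 0# (- 0#)) (trans (+-congˡ (-‿inverseʳ 0#)) (+-identityʳ 1#))
      }

    ⟦⟧-≟ : ∀ x y → Maybe (⟦ x ⟧ℤ ≈ ⟦ y ⟧ℤ)
    ⟦⟧-≟ (a , b) (c , d) with a ℕ.≟ c | b ℕ.≟ d
    ... | yes ≡.refl | yes ≡.refl = just refl
    ... | _          | _          = nothing

  open import Algebra.Solver.Ring ℤ₂-rawRing (fromCommutativeRing R) ⟦⟧-homo ⟦⟧-≟ public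

module FieldProperties {c ℓ} (F : Field c ℓ) where
  open Field F hiding (zero)
  open IntegerRingSolver commutativeRing
  open import Relation.Binary.Reasoning.Setoid setoid

  Nonzero : Carrier → Set ℓ
  Nonzero x = ¬ (x ≈ 0#)

  1≉0 : Nonzero 1#
  1≉0 1≈0 = 0≉1 (sym 1≈0)

  inverseˡ : ∀ {x} → Nonzero x → x ⁻¹ * x ≈ 1#
  inverseˡ {x} x≉0 = trans (*-comm _ _) (inverseʳ x x≉0)

  zeroʳ-≈ : ∀ x {y} → y ≈ 0# → x * y ≈ 0#
  zeroʳ-≈ x y≈0 = trans (*-congˡ y≈0) (zeroʳ x)

  zeroˡ-≈ : ∀ {x} y → x ≈ 0# → x * y ≈ 0#
  zeroˡ-≈ y x≈0 = trans (*-congʳ x≈0) (zeroˡ y)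

  ⁻¹-unique : ∀ {x y} → x * y ≈ 1# → x ⁻¹ ≈ y
  ⁻¹-unique {x} {y} xy≈1 = begin
    x ⁻¹            ≈⟨ sym (*-identityʳ _) ⟩
    x ⁻¹ * 1#       ≈⟨ *-congˡ (sym xy≈1) ⟩
    x ⁻¹ * (x * y)  ≈⟨ sym (*-assoc _ _ _) ⟩
    (x ⁻¹ * x) * y  ≈⟨ *-congʳ (inverseˡ x≉0) ⟩
    1# * y          ≈⟨ *-identityˡ y ⟩
    y               ∎
    where
    x≉0 : Nonzero x
    x≉0 x≈0 = 0≉1 (trans (sym (zeroˡ-≈ y x≈0)) xy≈1)

  *-cancelˡ-≈0 : ∀ {a x} → Nonzero a → a * x ≈ 0# → x ≈ 0#
  *-cancelˡ-≈0 {a} {x} a≉0 ax≈0 = begin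
    x               ≈⟨ sym (*-identityˡ x) ⟩
    1# * x          ≈⟨ *-congʳ (sym (inverseˡ a≉0)) ⟩
    (a ⁻¹ * a) * x  ≈⟨ *-assoc _ _ _ ⟩
    a ⁻¹ * (a * x)  ≈⟨ zeroʳ-≈ _ ax≈0 ⟩
    0#              ∎

  *-nonzero : ∀ {x y} → Nonzero x → Nonzero y → Nonzero (x * y)
  *-nonzero x≉0 y≉0 xy≈0 = y≉0 (*-cancelˡ-≈0 x≉0 xy≈0)

  ⁻¹-distrib-* : ∀ {x y} → Nonzero x → Nonzero y → (x * y) ⁻¹ ≈ x ⁻¹ * y ⁻¹
  ⁻¹-distrib-* {x} {y} x≉0 y≉0 = ⁻¹-unique (begin
    (x * y) * (x ⁻¹ * y ⁻¹)  ≈⟨ solve 4 (λ a b c d → (a :* b) :* (c :* d) := (a :* c) :* (b :* d)) refl x y (x ⁻¹) (y ⁻¹) ⟩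
    (x * x ⁻¹) * (y * y ⁻¹)  ≈⟨ *-cong (inverseʳ x x≉0) (inverseʳ y y≉0) ⟩
    1# * 1#                  ≈⟨ *-identityˡ 1# ⟩
    1#                       ∎)

  -- _⁻¹ is not required to respect ≈; it does so on nonzero elements by uniqueness of inverses.
  ⁻¹-cong : ∀ {x y} → Nonzero x → x ≈ y → x ⁻¹ ≈ y ⁻¹
  ⁻¹-cong {x} x≉0 x≈y = sym (⁻¹-unique (trans (*-congʳ (sym x≈y)) (inverseʳ x x≉0)))

  -‿⁻¹ : ∀ {x} → Nonzero x → (- x) ⁻¹ ≈ - (x ⁻¹)
  -‿⁻¹ {x} x≉0 = ⁻¹-unique
    (trans (solve 2 (λ x y → (:- x) :* (:- y) := x :* y) refl x (x ⁻¹)) (inverseʳ x x≉0))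

  −-nonzero-comm : ∀ {a b} → Nonzero (a - b) → Nonzero (b - a)
  −-nonzero-comm {a} {b} a-b≉0 b-a≈0 = a-b≉0 (begin
    a - b      ≈⟨ solve 2 (λ a b → a :- b := :- (b :- a)) refl a b ⟩
    - (b - a)  ≈⟨ -‿cong b-a≈0 ⟩
    - 0#       ≈⟨ sym (+-identityˡ _) ⟩
    0# - 0#    ≈⟨ -‿inverseʳ 0# ⟩
    0#         ∎)

  x*[y*x]⁻¹≈y⁻¹ : ∀ {x y} → Nonzero x → Nonzero y → x * (y * x) ⁻¹ ≈ y ⁻¹
  x*[y*x]⁻¹≈y⁻¹ {x} {y} x≉0 y≉0 = begin
    x * (y * x) ⁻¹     ≈⟨ *-congˡ (⁻¹-distrib-* y≉0 x≉0) ⟩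
    x * (y ⁻¹ * x ⁻¹)  ≈⟨ solve 3 (λ x a b → x :* (a :* b) := a :* (x :* b)) refl x (y ⁻¹) (x ⁻¹) ⟩
    y ⁻¹ * (x * x ⁻¹)  ≈⟨ *-congˡ (inverseʳ x x≉0) ⟩
    y ⁻¹ * 1#          ≈⟨ *-identityʳ _ ⟩
    y ⁻¹               ∎

  partialFraction : ∀ {d a b c} → Nonzero d → Nonzero (a - b) → Nonzero (a - c) →
    (b - c) * ((d * (a - b)) * (a - c)) ⁻¹ ≈ (d * (a - b)) ⁻¹ - (d * (a - c)) ⁻¹
  partialFraction {d} {a} {b} {c} d≉0 u≉0 v≉0 = begin
    (b - c) * ((d * u) * v) ⁻¹
      ≈⟨ *-congˡ (trans (⁻¹-distrib-* (*-nonzero d≉0 u≉0) v≉0) (*-congʳ (⁻¹-distrib-* d≉0 u≉0))) ⟩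
    (b - c) * ((d ⁻¹ * u ⁻¹) * v ⁻¹)
      ≈⟨ solve 6 (λ a b c d′ u′ v′ → (b :- c) :* ((d′ :* u′) :* v′)
                   := ((a :- c) :* v′) :* (d′ :* u′) :- ((a :- b) :* u′) :* (d′ :* v′))
               refl a b c (d ⁻¹) (u ⁻¹) (v ⁻¹) ⟩
    (v * v ⁻¹) * (d ⁻¹ * u ⁻¹) - (u * u ⁻¹) * (d ⁻¹ * v ⁻¹)
      ≈⟨ +-cong (trans (*-congʳ (inverseʳ v v≉0)) (*-identityˡ _))
                (-‿cong (trans (*-congʳ (inverseʳ u u≉0)) (*-identityˡ _))) ⟩
    d ⁻¹ * u ⁻¹ - d ⁻¹ * v ⁻¹
      ≈⟨ +-cong (sym (⁻¹-distrib-* d≉0 u≉0)) (-‿cong (sym (⁻¹-distrib-* d≉0 v≉0))) ⟩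
    (d * u) ⁻¹ - (d * v) ⁻¹ ∎
    where u = a - b; v = a - c

module WhitneyLah {c ℓ} (F : Field c ℓ) (m : Field.Carrier F) (α : ℕ → Field.Carrier F) where
  open Field F hiding (zero)
  open Whitney F m α
  open FieldProperties F
  open IntegerRingSolver commutativeRing
  open import Relation.Binary.Reasoning.Setoid setoid

  ∑-cong : ∀ N {f g} → (∀ t → t < N → f t ≈ g t) → ∑ N f ≈ ∑ N g
  ∑-cong zero    f≈g = refl
  ∑-cong (suc N) f≈g = +-cong (∑-cong N (λ t t<N → f≈g t (ℕ.m<n⇒m<1+n t<N))) (f≈g N (ℕ.n<1+n N))

  ∏-cong : ∀ N {f g} → (∀ t → t < N → f t ≈ g t) → ∏ N f ≈ ∏ N g
  ∏-cong zero    f≈g = refl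
  ∏-cong (suc N) f≈g = *-cong (∏-cong N (λ t t<N → f≈g t (ℕ.m<n⇒m<1+n t<N))) (f≈g N (ℕ.n<1+n N))

  ∑-length : ∀ {N M} f → N ≡ M → ∑ N f ≈ ∑ M f
  ∑-length f ≡.refl = refl

  ∏-length : ∀ {N M} f → N ≡ M → ∏ N f ≈ ∏ M f
  ∏-length f ≡.refl = refl

  ∑-zero : ∀ N {f} → (∀ t → t < N → f t ≈ 0#) → ∑ N f ≈ 0#
  ∑-zero zero    f≈0 = refl
  ∑-zero (suc N) f≈0 = trans (+-cong (∑-zero N (λ t t<N → f≈0 t (ℕ.m<n⇒m<1+n t<N))) (f≈0 N (ℕ.n<1+n N)))
                             (+-identityˡ 0#)

  ∑-+ : ∀ N f g → ∑ N (λ t → f t + g t) ≈ ∑ N f + ∑ N g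
  ∑-+ zero    f g = sym (+-identityʳ 0#)
  ∑-+ (suc N) f g = trans (+-congʳ (∑-+ N f g))
    (solve 4 (λ a b x y → (a :+ b) :+ (x :+ y) := (a :+ x) :+ (b :+ y)) refl (∑ N f) (∑ N g) (f N) (g N))

  ∑-- : ∀ N f → ∑ N (λ t → - f t) ≈ - ∑ N f
  ∑-- zero    f = sym (trans (sym (+-identityˡ (- 0#))) (-‿inverseʳ 0#))
  ∑-- (suc N) f = trans (+-congʳ (∑-- N f))
    (solve 2 (λ a b → (:- a) :+ (:- b) := :- (a :+ b)) refl (∑ N f) (f N))

  ∑-− : ∀ N f g → ∑ N (λ t → f t - g t) ≈ ∑ N f - ∑ N g
  ∑-− N f g = trans (∑-+ N f (λ t → - g t)) (+-congˡ (∑-- N g))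

  *-distribˡ-∑ : ∀ N a f → a * ∑ N f ≈ ∑ N (λ t → a * f t)
  *-distribˡ-∑ zero    a f = zeroʳ a
  *-distribˡ-∑ (suc N) a f = trans (distribˡ a _ _) (+-congʳ (*-distribˡ-∑ N a f))

  *-distribʳ-∑ : ∀ N a f → ∑ N f * a ≈ ∑ N (λ t → f t * a)
  *-distribʳ-∑ N a f = trans (*-comm _ a) (trans (*-distribˡ-∑ N a f) (∑-cong N (λ t _ → *-comm a (f t))))

  ∑-head : ∀ N f → ∑ (suc N) f ≈ f 0 + ∑ N (λ t → f (suc t))
  ∑-head zero    f = trans (+-identityˡ _) (sym (+-identityʳ _))
  ∑-head (suc N) f = trans (+-congʳ (∑-head N f)) (+-assoc _ _ _)

  ∑-split : ∀ a b f → ∑ (a ℕ.+ b) f ≈ ∑ a f + ∑ b (λ t → f (a ℕ.+ t))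
  ∑-split zero    b f = sym (+-identityˡ _)
  ∑-split (suc a) b f = begin
    ∑ (suc (a ℕ.+ b)) f                                    ≈⟨ ∑-head (a ℕ.+ b) f ⟩
    f 0 + ∑ (a ℕ.+ b) f′                                   ≈⟨ +-congˡ (∑-split a b f′) ⟩
    f 0 + (∑ a f′ + ∑ b (λ t → f′ (a ℕ.+ t)))              ≈⟨ sym (+-assoc _ _ _) ⟩
    (f 0 + ∑ a f′) + ∑ b (λ t → f′ (a ℕ.+ t))              ≈⟨ +-congʳ (sym (∑-head a f)) ⟩
    ∑ (suc a) f + ∑ b (λ t → f (suc a ℕ.+ t))              ∎
    where f′ = λ t → f (suc t)

  ∏-nonzero : ∀ N f → (∀ i → i < N → Nonzero (f i)) → Nonzero (∏ N f)
  ∏-nonzero zero    f f≉0 = 1≉0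
  ∏-nonzero (suc N) f f≉0 = *-nonzero (∏-nonzero N f (λ i i<N → f≉0 i (ℕ.m<n⇒m<1+n i<N))) (f≉0 N (ℕ.n<1+n N))

  unroll-recurrence : ∀ (x a c : ℕ → Carrier) → (∀ i → x (suc i) ≈ a i + c i * x i) →
    ∀ i₀ → x i₀ ≈ 0# → ∀ e →
    x (i₀ ℕ.+ e) ≈ ∑ e (λ t → a (i₀ ℕ.+ t) * ∏ (e ∸ suc t) (λ s → c (suc (i₀ ℕ.+ t ℕ.+ s))))
  unroll-recurrence x a c x-suc i₀ xi₀≈0 zero = trans (reflexive (≡.cong x (ℕ.+-identityʳ i₀))) xi₀≈0
  unroll-recurrence x a c x-suc i₀ xi₀≈0 (suc e) = begin
    x (i₀ ℕ.+ suc e)                         ≈⟨ reflexive (≡.cong x (ℕ.+-suc i₀ e)) ⟩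
    x (suc (i₀ ℕ.+ e))                       ≈⟨ x-suc (i₀ ℕ.+ e) ⟩
    a (i₀ ℕ.+ e) + c (i₀ ℕ.+ e) * x (i₀ ℕ.+ e)
      ≈⟨ +-congˡ (*-congˡ (unroll-recurrence x a c x-suc i₀ xi₀≈0 e)) ⟩
    a (i₀ ℕ.+ e) + c (i₀ ℕ.+ e) * ∑ e (term e)
      ≈⟨ trans (+-comm _ _) (+-cong (trans (*-comm _ _) (*-distribʳ-∑ e _ (term e))) (sym (*-identityʳ _))) ⟩
    ∑ e (λ t → term e t * c (i₀ ℕ.+ e)) + a (i₀ ℕ.+ e) * 1#
      ≈⟨ +-cong (∑-cong e grow) (*-congˡ (∏-length _ (≡.sym (ℕ.n∸n≡0 e)))) ⟩
    ∑ (suc e) (term (suc e))                 ∎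
    where
    term : ℕ → ℕ → Carrier
    term e t = a (i₀ ℕ.+ t) * ∏ (e ∸ suc t) (λ s → c (suc (i₀ ℕ.+ t ℕ.+ s)))

    grow : ∀ t → t < e → term e t * c (i₀ ℕ.+ e) ≈ term (suc e) t
    grow t t<e = begin
      (a (i₀ ℕ.+ t) * ∏ (e ∸ suc t) f) * c (i₀ ℕ.+ e)  ≈⟨ *-assoc _ _ _ ⟩
      a (i₀ ℕ.+ t) * (∏ (e ∸ suc t) f * c (i₀ ℕ.+ e))  ≈⟨ *-congˡ (*-congˡ (reflexive (≡.cong c (≡.sym (1+[i+t+[e∸[1+t]]]≡i+e i₀ t<e))))) ⟩
      a (i₀ ℕ.+ t) * ∏ (suc (e ∸ suc t)) f             ≈⟨ *-congˡ (∏-length f (≡.sym (ℕ.+-∸-assoc 1 t<e))) ⟩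
      term (suc e) t                                   ∎
      where f = λ s → c (suc (i₀ ℕ.+ t ℕ.+ s))

  w-vanishes : ∀ {n j} → n < j → w n j ≈ 0#
  w-vanishes {zero}  {suc j} _         = refl
  w-vanishes {suc n} {suc j} (s≤s n<j) = begin
    w n j - β n * w n (suc j)  ≈⟨ +-cong (w-vanishes n<j) (-‿cong (zeroʳ-≈ (β n) (w-vanishes (ℕ.m<n⇒m<1+n n<j)))) ⟩
    0# - 0#                    ≈⟨ -‿inverseʳ 0# ⟩
    0#                         ∎

  W-vanishes : ∀ {j k} → j < k → W j k ≈ 0#
  W-vanishes {zero}  {suc k} _         = refl
  W-vanishes {suc j} {suc k} (s≤s j<k) = begin
    W j k + β (suc k) * W j (suc k)  ≈⟨ +-cong (W-vanishes j<k) (zeroʳ-≈ (β (suc k)) (W-vanishes (ℕ.m<n⇒m<1+n j<k))) ⟩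
    0# + 0#                          ≈⟨ +-identityˡ 0# ⟩
    0#                               ∎

  w⁺ : ℕ → ℕ → Carrier
  w⁺ n j = negOnePow (n ∸ j) * w n j

  w⁺-suc-zero : ∀ n → w⁺ (suc n) 0 ≈ β n * w⁺ n 0
  w⁺-suc-zero n = solve 3 (λ s b x → (:- s) :* (:- (b :* x)) := b :* (s :* x)) refl (negOnePow n) (β n) (w n 0)

  w⁺-suc-suc : ∀ n j → w⁺ (suc n) (suc j) ≈ w⁺ n j + β n * w⁺ n (suc j)
  w⁺-suc-suc n j with j <? n
  ... | yes j<n = begin
    s * (x - b * y)          ≈⟨ *-congʳ (reflexive (≡.cong negOnePow (ℕ.+-∸-assoc 1 j<n))) ⟩
    (- s′) * (x - b * y)     ≈⟨ solve 4 (λ s x b y → (:- s) :* (x :- b :* y) := (:- s) :* x :+ b :* (s :* y)) refl s′ x b y ⟩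
    (- s′) * x + b * (s′ * y) ≈⟨ +-congʳ (*-congʳ (reflexive (≡.cong negOnePow (≡.sym (ℕ.+-∸-assoc 1 j<n))))) ⟩
    s * x + b * (s′ * y)     ∎
    where s = negOnePow (n ∸ j); s′ = negOnePow (n ∸ suc j); x = w n j; y = w n (suc j); b = β n
  ... | no j≮n = begin
    s * (x - b * y)          ≈⟨ solve 4 (λ s x b y → s :* (x :- b :* y) := s :* x :+ (:- (s :* b)) :* y) refl s x b y ⟩
    s * x + (- (s * b)) * y  ≈⟨ +-congˡ (zeroʳ-≈ _ y≈0) ⟩
    s * x + 0#               ≈⟨ +-congˡ (sym (zeroʳ-≈ _ y≈0)) ⟩
    s * x + (b * s′) * y     ≈⟨ +-congˡ (*-assoc _ _ _) ⟩
    s * x + b * (s′ * y)     ∎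
    where
    s = negOnePow (n ∸ j); s′ = negOnePow (n ∸ suc j); x = w n j; y = w n (suc j); b = β n
    y≈0 : y ≈ 0#
    y≈0 = w-vanishes (s≤s (ℕ.≮⇒≥ j≮n))

  -- The definition of L sums over k ≤ j ≤ n only; the terms with j < k vanish.
  L≈∑w⁺W : ∀ n k → L n k ≈ ∑ (suc n) (λ j → w⁺ n j * W j k)
  L≈∑w⁺W n k with k ≤? suc n
  ... | yes k≤1+n = sym (begin
    ∑ (suc n) f                                   ≈⟨ ∑-length f (≡.sym (ℕ.m+[n∸m]≡n k≤1+n)) ⟩
    ∑ (k ℕ.+ e) f                                 ≈⟨ ∑-split k e f ⟩
    ∑ k f + ∑ e (λ t → f (k ℕ.+ t))               ≈⟨ +-congʳ (∑-zero k (λ j j<k → zeroʳ-≈ _ (W-vanishes j<k))) ⟩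
    0# + ∑ e (λ t → f (k ℕ.+ t))                  ≈⟨ +-identityˡ _ ⟩
    ∑ e (λ t → f (k ℕ.+ t))                       ≈⟨ ∑-cong e (λ t _ → *-assoc _ _ _) ⟩
    L n k                                         ∎)
    where e = suc n ∸ k; f = λ j → w⁺ n j * W j k
  ... | no k≰1+n = begin
    L n k        ≈⟨ ∑-length _ (ℕ.m≤n⇒m∸n≡0 (ℕ.<⇒≤ n<k)) ⟩
    0#           ≈⟨ sym (∑-zero (suc n) (λ j j≤n → zeroʳ-≈ _ (W-vanishes (ℕ.<-≤-trans j≤n (ℕ.<⇒≤ n<k))))) ⟩
    ∑ (suc n) _  ∎
    where n<k = ℕ.≰⇒> k≰1+n

  L-suc : ∀ n k → L (suc n) k ≈ ∑ (suc n) (λ j → w⁺ n j * W (suc j) k) + β n * L n k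
  L-suc n k = begin
    L (suc n) k
      ≈⟨ L≈∑w⁺W (suc n) k ⟩
    ∑ (suc (suc n)) (λ j → w⁺ (suc n) j * W j k)
      ≈⟨ ∑-head (suc n) _ ⟩
    w⁺ (suc n) 0 * W 0 k + ∑ (suc n) (λ j → w⁺ (suc n) (suc j) * W (suc j) k)
      ≈⟨ +-cong (*-congʳ (w⁺-suc-zero n)) (∑-cong (suc n) (λ j _ → trans (*-congʳ (w⁺-suc-suc n j))
           (solve 4 (λ a b c d → (a :+ b :* c) :* d := a :* d :+ b :* (c :* d)) refl (w⁺ n j) (β n) (w⁺ n (suc j)) (W (suc j) k)))) ⟩
    (β n * w⁺ n 0) * W 0 k + ∑ (suc n) (λ j → w⁺ n j * W (suc j) k + β n * (w⁺ n (suc j) * W (suc j) k))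
      ≈⟨ +-congˡ (trans (∑-+ (suc n) _ _) (+-congˡ (sym (*-distribˡ-∑ (suc n) (β n) _)))) ⟩
    (β n * w⁺ n 0) * W 0 k + (S + β n * T)
      ≈⟨ solve 5 (λ b x w₀ s t → (b :* x) :* w₀ :+ (s :+ b :* t) := s :+ b :* (x :* w₀ :+ t)) refl (β n) (w⁺ n 0) (W 0 k) S T ⟩
    S + β n * (w⁺ n 0 * W 0 k + T)
      ≈⟨ +-congˡ (*-congˡ (sym (∑-head (suc n) _))) ⟩
    S + β n * ∑ (suc (suc n)) (λ j → w⁺ n j * W j k)
      ≈⟨ +-congˡ (*-congˡ (trans (+-congˡ (zeroˡ-≈ _ (zeroʳ-≈ _ (w-vanishes (ℕ.n<1+n n))))) (+-identityʳ _))) ⟩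
    S + β n * ∑ (suc n) (λ j → w⁺ n j * W j k)
      ≈⟨ +-congˡ (*-congˡ (sym (L≈∑w⁺W n k))) ⟩
    S + β n * L n k ∎
    where
    S = ∑ (suc n) (λ j → w⁺ n j * W (suc j) k)
    T = ∑ (suc n) (λ j → w⁺ n (suc j) * W (suc j) k)

  L-suc-zero : ∀ n → L (suc n) 0 ≈ (β 0 + β n) * L n 0
  L-suc-zero n = begin
    L (suc n) 0                                       ≈⟨ L-suc n 0 ⟩
    ∑ (suc n) (λ j → w⁺ n j * W (suc j) 0) + β n * L n 0
      ≈⟨ +-congʳ (trans (∑-cong (suc n) (λ j _ → solve 3 (λ x b y → x :* (b :* y) := b :* (x :* y)) refl (w⁺ n j) (β 0) (W j 0)))
                        (sym (*-distribˡ-∑ (suc n) (β 0) _))) ⟩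
    β 0 * ∑ (suc n) (λ j → w⁺ n j * W j 0) + β n * L n 0  ≈⟨ +-congʳ (*-congˡ (sym (L≈∑w⁺W n 0))) ⟩
    β 0 * L n 0 + β n * L n 0                          ≈⟨ sym (distribʳ _ _ _) ⟩
    (β 0 + β n) * L n 0                                ∎

  L-suc-suc : ∀ n k → L (suc n) (suc k) ≈ L n k + (β (suc k) + β n) * L n (suc k)
  L-suc-suc n k = begin
    L (suc n) (suc k)                                            ≈⟨ L-suc n (suc k) ⟩
    ∑ (suc n) (λ j → w⁺ n j * W (suc j) (suc k)) + β n * L n (suc k)
      ≈⟨ +-congʳ (trans (∑-cong (suc n) (λ j _ →
            solve 4 (λ x a b y → x :* (a :+ b :* y) := x :* a :+ b :* (x :* y)) refl (w⁺ n j) (W j k) (β (suc k)) (W j (suc k))))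
          (trans (∑-+ (suc n) _ _) (+-congˡ (sym (*-distribˡ-∑ (suc n) (β (suc k)) _))))) ⟩
    (∑ (suc n) (λ j → w⁺ n j * W j k) + β (suc k) * ∑ (suc n) (λ j → w⁺ n j * W j (suc k))) + β n * L n (suc k)
      ≈⟨ +-congʳ (+-cong (sym (L≈∑w⁺W n k)) (*-congˡ (sym (L≈∑w⁺W n (suc k))))) ⟩
    (L n k + β (suc k) * L n (suc k)) + β n * L n (suc k)
      ≈⟨ solve 4 (λ a b c l → (a :+ b :* l) :+ c :* l := a :+ (b :+ c) :* l) refl (L n k) (β (suc k)) (β n) (L n (suc k)) ⟩
    L n k + (β (suc k) + β n) * L n (suc k)                     ∎

  L-vanishes : ∀ {n k} → n < k → L n k ≈ 0#
  L-vanishes n<k = ∑-length _ (ℕ.m≤n⇒m∸n≡0 n<k)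

  L-column-expansion : ∀ n k → 1 ≤ k → k ≤ n → L n k ≈
    ∑ (suc n ∸ k) (λ t → L (k ℕ.+ t ∸ 1) (k ∸ 1) * ∏ (n ∸ (k ℕ.+ t)) (λ s → β (k ℕ.+ t ℕ.+ s) + β k))
  L-column-expansion n (suc k) (s≤s z≤n) 1+k≤n = begin
    L n (suc k)
      ≈⟨ reflexive (≡.cong (λ i → L i (suc k)) (≡.sym (ℕ.m+[n∸m]≡n k≤n))) ⟩
    L (k ℕ.+ (n ∸ k)) (suc k)
      ≈⟨ unroll-recurrence (λ i → L i (suc k)) (λ i → L i k) (λ i → β (suc k) + β i)
           (λ i → L-suc-suc i k) k (L-vanishes (ℕ.n<1+n k)) (n ∸ k) ⟩
    ∑ (n ∸ k) (λ t → L (k ℕ.+ t) k * ∏ ((n ∸ k) ∸ suc t) (λ s → β (suc k) + β (suc (k ℕ.+ t ℕ.+ s))))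
      ≈⟨ ∑-cong (n ∸ k) (λ t _ → *-congˡ (trans (∏-length _ (length-≡ t)) (∏-cong (n ∸ (suc k ℕ.+ t)) (λ s _ → +-comm _ _)))) ⟩
    ∑ (n ∸ k) (λ t → L (k ℕ.+ t) k * ∏ (n ∸ (suc k ℕ.+ t)) (λ s → β (suc k ℕ.+ t ℕ.+ s) + β (suc k))) ∎
    where
    k≤n = ℕ.<⇒≤ 1+k≤n
    length-≡ : ∀ t → (n ∸ k) ∸ suc t ≡ n ∸ (suc k ℕ.+ t)
    length-≡ t = ≡.trans (ℕ.∸-+-assoc n k (suc t)) (≡.cong (n ∸_) (ℕ.+-suc k t))

  module ClosedForm (β-injective : ∀ i j → β i ≈ β j → i ≡ j) where

    β-distinct : ∀ {i j} → i ≢ j → Nonzero (β i - β j)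
    β-distinct {i} {j} i≢j βi-βj≈0 = i≢j (β-injective i j (begin
      β i                ≈⟨ solve 2 (λ a b → a := (a :- b) :+ b) refl (β i) (β j) ⟩
      (β i - β j) + β j  ≈⟨ +-congʳ βi-βj≈0 ⟩
      0# + β j           ≈⟨ +-identityˡ _ ⟩
      β j                ∎))

    Δ : ℕ → ℕ → Carrier
    Δ j K = ∏ K (λ i → if i ≡ᵇ j then 1# else (β j - β i))

    Δ-nonzero : ∀ j K → Nonzero (Δ j K)
    Δ-nonzero j K = ∏-nonzero K _ (λ i _ → factor-nonzero i)
      where
      factor-nonzero : ∀ i → Nonzero (if i ≡ᵇ j then 1# else (β j - β i))
      factor-nonzero i with i ℕ.≟ j
      ... | yes ≡.refl = ≡.subst Nonzero (≡.sym (if-≡ᵇ-refl i)) 1≉0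
      ... | no i≢j     = ≡.subst Nonzero (≡.sym (if-≡ᵇ-≢ i≢j)) (β-distinct (≢-sym i≢j))

    Δ-suc : ∀ {j K} → j < K → Δ j (suc K) ≡ Δ j K * (β j - β K)
    Δ-suc {j} {K} j<K = ≡.cong (Δ j K *_) (if-≡ᵇ-≢ (ℕ.>⇒≢ j<K))

    Δ-suc-self : ∀ K → Δ K (suc K) ≈ ∏ K (λ i → β K - β i)
    Δ-suc-self K = trans (*-congˡ (reflexive (if-≡ᵇ-refl K))) (trans (*-identityʳ _)
      (∏-cong K (λ i i<K → reflexive (if-≡ᵇ-≢ (ℕ.<⇒≢ i<K)))))

    -- ∑ over the K + 1 points x ∈ {β 0, …, β (K − 1), c} of 1 / ∏_{y ≠ x} (x − y)
    partialFractions : ℕ → Carrier → Carrier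
    partialFractions K c = ∑ K (λ j → (Δ j K * (β j - c)) ⁻¹) + (∏ K (λ i → c - β i)) ⁻¹

    partialFractions-suc : ∀ K c → (∀ i → i ≤ K → Nonzero (β i - c)) →
      (β K - c) * partialFractions (suc K) c ≈ partialFractions K (β K) - partialFractions K c
    partialFractions-suc K c βi-c≉0 = begin
      d * ((∑ K A + A K) + B)
        ≈⟨ solve 4 (λ d s a b → d :* ((s :+ a) :+ b) := (d :* s :+ d :* a) :+ d :* b) refl d (∑ K A) (A K) B ⟩
      (d * ∑ K A + d * A K) + d * B
        ≈⟨ +-cong (+-cong (trans (*-distribˡ-∑ K d A) (trans (∑-cong K split) (∑-− K _ _))) last) (d*B≈-G⁻¹) ⟩
      ((∑ K (λ j → (Δ j K * (β j - β K)) ⁻¹) - ∑ K (λ j → (Δ j K * (β j - c)) ⁻¹)) + E ⁻¹) + - G ⁻¹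
        ≈⟨ solve 4 (λ a b e g → ((a :- b) :+ e) :+ (:- g) := (a :+ e) :- (b :+ g)) refl _ _ (E ⁻¹) (G ⁻¹) ⟩
      partialFractions K (β K) - partialFractions K c ∎
      where
      d = β K - c
      A = λ j → (Δ j (suc K) * (β j - c)) ⁻¹
      B = (∏ (suc K) (λ i → c - β i)) ⁻¹
      E = ∏ K (λ i → β K - β i)
      G = ∏ K (λ i → c - β i)
      d≉0 = βi-c≉0 K ℕ.≤-refl

      split : ∀ j → j < K → d * A j ≈ (Δ j K * (β j - β K)) ⁻¹ - (Δ j K * (β j - c)) ⁻¹
      split j j<K = trans (*-congˡ (reflexive (≡.cong (λ x → (x * (β j - c)) ⁻¹) (Δ-suc j<K))))
        (partialFraction (Δ-nonzero j K) (β-distinct (ℕ.<⇒≢ j<K)) (βi-c≉0 j (ℕ.<⇒≤ j<K)))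

      last : d * A K ≈ E ⁻¹
      last = trans (x*[y*x]⁻¹≈y⁻¹ d≉0 (Δ-nonzero K (suc K))) (⁻¹-cong (Δ-nonzero K (suc K)) (Δ-suc-self K))

      d*B≈-G⁻¹ : d * B ≈ - G ⁻¹
      d*B≈-G⁻¹ = begin
        d * (G * (c - β K)) ⁻¹     ≈⟨ *-congˡ (⁻¹-distrib-* G≉0 (−-nonzero-comm d≉0)) ⟩
        d * (G ⁻¹ * (c - β K) ⁻¹)  ≈⟨ *-congˡ (*-congˡ (trans (⁻¹-cong (−-nonzero-comm d≉0) c-βK≈-d) (-‿⁻¹ d≉0))) ⟩
        d * (G ⁻¹ * - d ⁻¹)        ≈⟨ solve 3 (λ d g e → d :* (g :* (:- e)) := (:- g) :* (d :* e)) refl d (G ⁻¹) (d ⁻¹) ⟩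
        - G ⁻¹ * (d * d ⁻¹)        ≈⟨ trans (*-congˡ (inverseʳ d d≉0)) (*-identityʳ _) ⟩
        - G ⁻¹                     ∎
        where
        G≉0 = ∏-nonzero K _ (λ i i<K → −-nonzero-comm (βi-c≉0 i (ℕ.<⇒≤ i<K)))
        c-βK≈-d = solve 2 (λ b c → c :- b := :- (b :- c)) refl (β K) c

    partialFractions-vanishes : ∀ K c → (∀ i → i ≤ K → Nonzero (β i - c)) → partialFractions (suc K) c ≈ 0#
    partialFractions-vanishes K c βi-c≉0 =
      *-cancelˡ-≈0 (βi-c≉0 K ℕ.≤-refl) (trans (partialFractions-suc K c βi-c≉0) (difference≈0 K βi-c≉0))
      where
      -- for K = 0 both sums equal (∏ 0 _) ⁻¹, whatever the extra point
      difference≈0 : ∀ K → (∀ i → i ≤ K → Nonzero (β i - c)) → partialFractions K (β K) - partialFractions K c ≈ 0#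
      difference≈0 zero    _       = -‿inverseʳ _
      difference≈0 (suc K) βi-c≉0 = begin
        partialFractions (suc K) (β (suc K)) - partialFractions (suc K) c
          ≈⟨ +-cong (partialFractions-vanishes K (β (suc K)) (λ i i≤K → β-distinct (ℕ.<⇒≢ (s≤s i≤K))))
                    (-‿cong (partialFractions-vanishes K c (λ i i≤K → βi-c≉0 i (ℕ.m≤n⇒m≤1+n i≤K)))) ⟩
        0# - 0#  ≈⟨ -‿inverseʳ 0# ⟩
        0#       ∎

    closedForm : ℕ → ℕ → Carrier
    closedForm n k = ∑ (suc k) (λ j → ∏ n (λ i → β j + β i) * (denom j k) ⁻¹)

    closedForm′ : ℕ → ℕ → Carrier
    closedForm′ n k = ∑ (suc k) (λ j → (∏ n (λ i → β j + β i) * (β j - β k)) * (denom j k) ⁻¹)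

    closedForm-suc : ∀ n k → closedForm (suc n) k ≈ closedForm′ n k + (β k + β n) * closedForm n k
    closedForm-suc n k = begin
      closedForm (suc n) k
        ≈⟨ ∑-cong (suc k) (λ j _ → solve 5 (λ p bj bn bk i → (p :* (bj :+ bn)) :* i := (p :* (bj :- bk)) :* i :+ (bk :+ bn) :* (p :* i))
                                      refl (∏ n (λ i → β j + β i)) (β j) (β n) (β k) ((denom j k) ⁻¹)) ⟩
      ∑ (suc k) (λ j → (∏ n (λ i → β j + β i) * (β j - β k)) * (denom j k) ⁻¹ + (β k + β n) * (∏ n (λ i → β j + β i) * (denom j k) ⁻¹))
        ≈⟨ ∑-+ (suc k) _ _ ⟩
      closedForm′ n k + ∑ (suc k) (λ j → (β k + β n) * (∏ n (λ i → β j + β i) * (denom j k) ⁻¹))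
        ≈⟨ +-congˡ (sym (*-distribˡ-∑ (suc k) (β k + β n) _)) ⟩
      closedForm′ n k + (β k + β n) * closedForm n k ∎

    closedForm′-zero : ∀ n → closedForm′ n 0 ≈ 0#
    closedForm′-zero n = trans (+-identityˡ _) (zeroˡ-≈ _ (zeroʳ-≈ _ (-‿inverseʳ (β 0))))

    closedForm′-suc : ∀ n k → closedForm′ n (suc k) ≈ closedForm n k
    closedForm′-suc n k = begin
      closedForm′ n (suc k)
        ≈⟨ trans (+-congˡ (zeroˡ-≈ _ (zeroʳ-≈ _ (-‿inverseʳ (β (suc k)))))) (+-identityʳ _) ⟩
      ∑ (suc k) (λ j → (∏ n (λ i → β j + β i) * (β j - β (suc k))) * (denom j (suc k)) ⁻¹)
        ≈⟨ ∑-cong (suc k) cancel ⟩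
      closedForm n k ∎
      where
      cancel : ∀ j → j < suc k → (∏ n (λ i → β j + β i) * (β j - β (suc k))) * (denom j (suc k)) ⁻¹
                                 ≈ ∏ n (λ i → β j + β i) * (denom j k) ⁻¹
      cancel j j<1+k = begin
        (p * u) * (Δ j (suc (suc k))) ⁻¹  ≈⟨ *-congˡ (reflexive (≡.cong _⁻¹ (Δ-suc j<1+k))) ⟩
        (p * u) * (denom j k * u) ⁻¹     ≈⟨ *-congˡ (⁻¹-distrib-* (Δ-nonzero j (suc k)) u≉0) ⟩
        (p * u) * ((denom j k) ⁻¹ * u ⁻¹) ≈⟨ solve 4 (λ p u d v → (p :* u) :* (d :* v) := (p :* d) :* (u :* v)) refl p u ((denom j k) ⁻¹) (u ⁻¹) ⟩
        (p * (denom j k) ⁻¹) * (u * u ⁻¹) ≈⟨ trans (*-congˡ (inverseʳ u u≉0)) (*-identityʳ _) ⟩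
        p * (denom j k) ⁻¹               ∎
        where
        p = ∏ n (λ i → β j + β i)
        u = β j - β (suc k)
        u≉0 = β-distinct (ℕ.<⇒≢ j<1+k)

    closedForm-zero-suc : ∀ k → closedForm 0 (suc k) ≈ 0#
    closedForm-zero-suc k = trans as-partialFractions
      (partialFractions-vanishes k (β (suc k)) (λ i i≤k → β-distinct (ℕ.<⇒≢ (s≤s i≤k))))
      where
      as-partialFractions : closedForm 0 (suc k) ≈ partialFractions (suc k) (β (suc k))
      as-partialFractions = +-cong
        (∑-cong (suc k) (λ j j<1+k → trans (*-identityˡ _) (reflexive (≡.cong _⁻¹ (Δ-suc j<1+k)))))
        (trans (*-identityˡ _) (⁻¹-cong (Δ-nonzero (suc k) (suc (suc k))) (Δ-suc-self (suc k))))

    L≈closedForm : ∀ n k → L n k ≈ closedForm n k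
    L≈closedForm zero    zero    = begin
      0# + 1# * (1# * 1#)         ≈⟨ +-identityˡ _ ⟩
      1# * (1# * 1#)              ≈⟨ *-identityˡ _ ⟩
      1# * 1#                     ≈⟨ *-congˡ (sym (⁻¹-unique (trans (*-identityʳ _) (*-identityˡ 1#)))) ⟩
      1# * (1# * 1#) ⁻¹           ≈⟨ sym (+-identityˡ _) ⟩
      0# + 1# * (1# * 1#) ⁻¹      ∎
    L≈closedForm zero    (suc k) = trans (L-vanishes {0} {suc k} (s≤s z≤n)) (sym (closedForm-zero-suc k))
    L≈closedForm (suc n) zero    = begin
      L (suc n) 0                   ≈⟨ L-suc-zero n ⟩
      (β 0 + β n) * L n 0           ≈⟨ *-congˡ (L≈closedForm n 0) ⟩
      (β 0 + β n) * closedForm n 0  ≈⟨ sym (trans (closedForm-suc n 0) (trans (+-congʳ (closedForm′-zero n)) (+-identityˡ _))) ⟩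
      closedForm (suc n) 0          ∎
    L≈closedForm (suc n) (suc k) = begin
      L (suc n) (suc k)                                            ≈⟨ L-suc-suc n k ⟩
      L n k + (β (suc k) + β n) * L n (suc k)                      ≈⟨ +-cong (L≈closedForm n k) (*-congˡ (L≈closedForm n (suc k))) ⟩
      closedForm n k + (β (suc k) + β n) * closedForm n (suc k)    ≈⟨ sym (trans (closedForm-suc n (suc k)) (+-congʳ (closedForm′-suc n k))) ⟩
      closedForm (suc n) (suc k)                                   ∎

open import Data.Nat using (_+_)

mainTheorem11 : {c ℓ : Level} (F : Field c ℓ) (m : Field.Carrier F) (α : ℕ → Field.Carrier F) →
    (∀ i j → Field._≈_ F (Whitney.β F m α i) (Whitney.β F m α j) → i ≡ j) →
    (∀ n k → Field._≈_ F (Whitney.L F m α n k)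
        (Whitney.∑ F m α (suc k) (λ j → Field._*_ F
          (Whitney.∏ F m α n (λ i → Field._+_ F (Whitney.β F m α j) (Whitney.β F m α i)))
          (Field._⁻¹ F (Whitney.denom F m α j k)))))
    × (∀ n k → 1 ≤ k → k ≤ n → Field._≈_ F (Whitney.L F m α n k)
        (Whitney.∑ F m α (suc n ∸ k) (λ t → Field._*_ F
          (Whitney.L F m α (k + t ∸ 1) (k ∸ 1))
          (Whitney.∏ F m α (n ∸ (k + t)) (λ s → Field._+_ F (Whitney.β F m α (k + t + s)) (Whitney.β F m α k))))))
mainTheorem11 F m α β-injective = L≈closedForm , L-column-expansion
  where
  open WhitneyLah F m α
  open ClosedForm β-injective
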